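{- Let $P$ be a finite set, and let $a,d,r$ be integers with $1\le a\le |P|$, $d\ge 1$ and $1\le r\le d+1$. Call a tuple $(S_1,\dots,S_d)\in\binom{P}{a}^d$ $r$-good if there are indices $i_1<\dots<i_r$ such that $S_{i_1},\dots,S_{i_r}$ are pairwise disjoint, and $r$-bad otherwise. Then the number of $r$-bad tuples in $\binom{P}{a}^d$ is at most \[ C(d)\,\bigl(a^2/|P|\bigr)^{d-r+1}\binom{|P|}{a}^d, \] where $C(d)$ is a constant depending only on $d$.
   Context: $\binom{P}{a}$ denotes the family of all $a$-element subsets of $P$, and $\binom{P}{a}^d$ the set of $d$-tuples of such subsets. -}

module Defs where

open import Data.Nat using (ℕ)
open import Data.Fin using (Fin; _<_)
open import Data.Fin.Subset using (Subset; _∩_; Empty; ∣_∣)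
open import Data.Vec using (Vec; lookup)
open import Data.Product using (Σ; _×_)
open import Relation.Binary.PropositionalEquality using (_≡_; _≢_)
open import Relation.Nullary using (¬_)

Disjoint : {n : ℕ} → Subset n → Subset n → Set
Disjoint S T = Empty (S ∩ T)

Tuple : ℕ → ℕ → Set
Tuple n d = Vec (Subset n) d

AllOfSize : {n d : ℕ} → ℕ → Tuple n d → Set
AllOfSize {d = d} a S = (i : Fin d) → ∣ lookup S i ∣ ≡ a

Good : {n d : ℕ} → ℕ → Tuple n d → Set
Good {d = d} r S =
  Σ (Fin r → Fin d) λ f →
    ((j k : Fin r) → j < k → f j < f k) ×
    ((j k : Fin r) → j ≢ k → Disjoint (lookup S (f j)) (lookup S (f k)))

Bad : {n d : ℕ} → ℕ → Tuple n d → Set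
Bad r S = ¬ Good r S

-- Read a tuple (S₁,…,S_d) of a-subsets of an n-set from left to right and call S_i
-- stale if it meets an earlier entry, fresh otherwise.  Fresh entries are pairwise
-- disjoint, so an r-bad tuple has fewer than r fresh entries, i.e. at least
-- m = d+1-r stale ones.  Such tuples are counted entry by entry: a fresh entry is one
-- of at most C(n,a) a-subsets, a stale one meets one of the (at most d) earlier entries
-- and so is one of at most d·a·C(n-1,a-1) = d·(a²/n)·C(n,a) a-subsets.  Induction on
-- the length of the tuple gives
--     #{tuples with at least m stale entries} · n^m ≤ (d+1)^d · (a²)^m · C(n,a)^d,
-- which is the theorem with C(d) = (d+1)^d.
--
-- Finite families are represented by duplicate-free lists, so every count bounds the
-- length of such a list.
module Submission where

open import Defs
open import Data.Nat using (ℕ; zero; suc; _+_; _*_; _∸_; _^_; _≤_; _<_; z≤n; s≤s; _≤?_)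
open import Data.Nat.Properties
open import Data.Nat.ListAction using (sum)
open import Data.Nat.Combinatorics using (_C_; nC1≡n) renaming (nCk+nC[k+1]≡[n+1]C[k+1] to pascal)
open import Data.Nat.Tactic.RingSolver using (solve-∀)
open import Algebra.Properties.CommutativeSemigroup *-commutativeSemigroup using (x∙yz≈y∙xz)
open import Data.Bool using (Bool; true; false; _∧_; _∨_; not; if_then_else_)
import Data.Bool as Bool
open import Data.Bool.Properties using (¬-not)
open import Data.Product using (Σ; ∃; _×_; _,_; proj₁)
open import Data.Empty using (⊥-elim)
open import Data.List using (List; []; _∷_; length; map; filter; deduplicate)
open import Data.List.Relation.Unary.All as All using (All; []; _∷_)
import Data.List.Relation.Unary.All.Properties as All
open import Data.List.Relation.Unary.Any using (here; there)
open import Data.List.Relation.Unary.Unique.Propositional using (Unique; []; _∷_)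
import Data.List.Relation.Unary.Unique.Propositional.Properties as Unique
open import Data.List.Relation.Unary.Unique.DecPropositional.Properties using (deduplicate-!)
open import Data.List.Membership.Propositional using (_∈_)
open import Data.List.Membership.Propositional.Properties using (∈-map⁺; ∈-deduplicate⁺)
open import Data.Vec using (Vec; []; _∷_; head; lookup; _[_]=_)
open _[_]=_ using (there)
open import Data.Vec.Properties using (≡-dec)
open import Data.Vec.Relation.Unary.All as VecAll using ([]; _∷_) renaming (All to VecAll)
import Data.Vec.Relation.Unary.All.Properties as VecAll
open import Data.Fin using (Fin; zero; suc)
import Data.Fin as F
open import Data.Fin.Subset using (Subset; ∣_∣; Empty)
open import Data.Fin.Subset.Properties using (∩-comm)
open import Relation.Nullary using (yes; no)
open import Relation.Unary using (Decidable)
open import Relation.Unary.Properties using (∁?)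
open import Relation.Binary.Definitions using (DecidableEquality)
open import Relation.Binary.PropositionalEquality

-- The tuples of the
-- theorem are vectors, and every bound is obtained by grouping a list of
-- distinct vectors according to the first entry and bounding each group.
module ByHead {X : Set} (_≟_ : DecidableEquality X) {k : ℕ} where

  fibre : X → List (Vec X (suc k)) → List (Vec X k)
  fibre h [] = []
  fibre h ((x ∷ t) ∷ L) with x ≟ h
  ... | yes _ = t ∷ fibre h L
  ... | no _ = fibre h L

  others : X → List (Vec X (suc k)) → List (Vec X (suc k))
  others h [] = []
  others h ((x ∷ t) ∷ L) with x ≟ h
  ... | yes _ = others h L
  ... | no _ = (x ∷ t) ∷ others h L

  length-fibre-others : ∀ h L → length L ≡ length (fibre h L) + length (others h L)
  length-fibre-others h [] = refl
  length-fibre-others h ((x ∷ t) ∷ L) with x ≟ h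
  ... | yes _ = cong suc (length-fibre-others h L)
  ... | no _ = trans (cong suc (length-fibre-others h L)) (sym (+-suc _ _))

  fibre-all : {R : Vec X (suc k) → Set} (h : X) {L : List (Vec X (suc k))} →
    All R L → All (λ t → R (h ∷ t)) (fibre h L)
  fibre-all h [] = []
  fibre-all h {(x ∷ t) ∷ _} (r ∷ rs) with x ≟ h
  ... | yes refl = r ∷ fibre-all h rs
  ... | no _ = fibre-all h rs

  others-all : {R : Vec X (suc k) → Set} (h : X) {L : List (Vec X (suc k))} →
    All (λ v → head v ≢ h → R v) L → All R (others h L)
  others-all h [] = []
  others-all h {(x ∷ t) ∷ _} (r ∷ rs) with x ≟ h
  ... | yes _ = others-all h rs
  ... | no x≢h = r x≢h ∷ others-all h rs

  fibre-unique : (h : X) {L : List (Vec X (suc k))} → Unique L → Unique (fibre h L)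
  fibre-unique h [] = []
  fibre-unique h {(x ∷ t) ∷ _} (u ∷ us) with x ≟ h
  ... | yes refl = All.map (λ ne eq → ne (cong (x ∷_) eq)) (fibre-all h u) ∷ fibre-unique h us
  ... | no _ = fibre-unique h us

  others-unique : (h : X) {L : List (Vec X (suc k))} → Unique L → Unique (others h L)
  others-unique h [] = []
  others-unique h {(x ∷ t) ∷ _} (u ∷ us) with x ≟ h
  ... | yes _ = others-unique h us
  ... | no _ = others-all h (All.map (λ ne _ → ne) u) ∷ others-unique h us

  count-by-head : (R : Vec X (suc k) → Set) (M : ℕ) (f : X → ℕ) →
    (∀ h (G : List (Vec X k)) → Unique G → All (λ t → R (h ∷ t)) G → length G * M ≤ f h) →
    (hs : List X) (L : List (Vec X (suc k))) → Unique L → All R L → All (λ v → head v ∈ hs) L →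
    length L * M ≤ sum (map f hs)
  count-by-head R M f bound [] [] _ _ _ = z≤n
  count-by-head R M f bound [] (_ ∷ _) _ _ (() ∷ _)
  count-by-head R M f bound (h ∷ hs) L U A cover = begin
    length L * M
      ≡⟨ cong (_* M) (length-fibre-others h L) ⟩
    (length (fibre h L) + length (others h L)) * M
      ≡⟨ *-distribʳ-+ M (length (fibre h L)) _ ⟩
    length (fibre h L) * M + length (others h L) * M
      ≤⟨ +-mono-≤ (bound h _ (fibre-unique h U) (fibre-all h A))
                  (count-by-head R M f bound hs _ (others-unique h U) (others-all h (All.map (λ r _ → r) A))
                     (others-all h (All.map (λ {v} → drop-h {v}) cover))) ⟩
    f h + sum (map f hs) ∎
    where
    open ≤-Reasoning
    drop-h : ∀ {v} → head v ∈ h ∷ hs → head v ≢ h → head v ∈ hs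
    drop-h (here eq) ne = ⊥-elim (ne eq)
    drop-h (there p) _ = p

  sum-const : (c : ℕ) (hs : List X) → sum (map (λ _ → c) hs) ≡ length hs * c
  sum-const c [] = refl
  sum-const c (_ ∷ hs) = cong (c +_) (sum-const c hs)

  count-by-distinct-heads : (R : Vec X (suc k) → Set) (M c : ℕ) →
    (∀ h (G : List (Vec X k)) → Unique G → All (λ t → R (h ∷ t)) G → length G * M ≤ c) →
    (L : List (Vec X (suc k))) → Unique L → All R L →
    Σ (List X) λ hs → Unique hs × All (λ h → ∃ λ t → R (h ∷ t)) hs × length L * M ≤ length hs * c
  count-by-distinct-heads R M c bound L U A =
    hs , deduplicate-! _≟_ (map head L) , All.deduplicate⁺ _ (All.map⁺ (All.map witness A)) ,
    ≤-trans (count-by-head R M (λ _ → c) bound hs L U A (All.tabulate λ v∈L → ∈-deduplicate⁺ _≟_ (∈-map⁺ head v∈L)))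
            (≤-reflexive (sum-const c hs))
    where
    hs : List X
    hs = deduplicate _≟_ (map head L)
    witness : ∀ {v} → R v → ∃ λ t → R (head v ∷ t)
    witness {_ ∷ t} r = t , r

open ByHead using (count-by-head; count-by-distinct-heads)

unique-nil-vectors : {X : Set} (L : List (Vec X 0)) → Unique L → length L ≤ 1
unique-nil-vectors [] _ = z≤n
unique-nil-vectors ([] ∷ []) _ = ≤-refl
unique-nil-vectors ([] ∷ [] ∷ _) ((ne ∷ _) ∷ _) = ⊥-elim (ne refl)

length-filter-split : {A : Set} {P : A → Set} (P? : Decidable P) (xs : List A) →
  length (filter P? xs) + length (filter (∁? P?) xs) ≡ length xs
length-filter-split P? [] = refl
length-filter-split P? (x ∷ xs) with P? x
... | yes _ = cong suc (length-filter-split P? xs)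
... | no _ = trans (+-suc _ _) (cong suc (length-filter-split P? xs))

count-by-Bool-head : {k : ℕ} (R : Vec Bool (suc k) → Set) (c₁ c₀ : ℕ) →
  (∀ G → Unique G → All (λ t → R (true ∷ t)) G → length G ≤ c₁) →
  (∀ G → Unique G → All (λ t → R (false ∷ t)) G → length G ≤ c₀) →
  (L : List (Vec Bool (suc k))) → Unique L → All R L → length L ≤ c₁ + c₀
count-by-Bool-head R c₁ c₀ bound₁ bound₀ L U A = begin
  length L ≡⟨ *-identityʳ (length L) ⟨
  length L * 1 ≤⟨ count-by-head Bool._≟_ R 1 f bound (true ∷ false ∷ []) L U A (All.universal covered L) ⟩
  c₁ + (c₀ + 0) ≡⟨ cong (c₁ +_) (+-identityʳ c₀) ⟩
  c₁ + c₀ ∎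
  where
  open ≤-Reasoning
  f : Bool → ℕ
  f true = c₁
  f false = c₀
  bound : ∀ h G → Unique G → All (λ t → R (h ∷ t)) G → length G * 1 ≤ f h
  bound true G GU GA = ≤-trans (≤-reflexive (*-identityʳ _)) (bound₁ G GU GA)
  bound false G GU GA = ≤-trans (≤-reflexive (*-identityʳ _)) (bound₀ G GU GA)
  covered : ∀ (v : Vec Bool (suc _)) → head v ∈ true ∷ false ∷ []
  covered (true ∷ _) = here refl
  covered (false ∷ _) = there (here refl)

absorption : ∀ n k → suc k * (suc n C suc k) ≡ suc n * (n C k)
absorption zero zero = refl
absorption zero (suc k) = *-zeroʳ (suc (suc k))
absorption (suc n) zero = trans (*-identityˡ _) (trans (nC1≡n (suc (suc n))) (sym (*-identityʳ _)))
absorption (suc n) (suc k) = begin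
  suc (suc k) * (suc (suc n) C suc (suc k))
    ≡⟨ cong (suc (suc k) *_) (sym (pascal (suc n) (suc k))) ⟩
  suc (suc k) * (suc n C suc k + suc n C suc (suc k))
    ≡⟨ *-distribˡ-+ (suc (suc k)) (suc n C suc k) _ ⟩
  suc n C suc k + suc k * (suc n C suc k) + suc (suc k) * (suc n C suc (suc k))
    ≡⟨ +-assoc (suc n C suc k) _ _ ⟩
  suc n C suc k + (suc k * (suc n C suc k) + suc (suc k) * (suc n C suc (suc k)))
    ≡⟨ cong (suc n C suc k +_) (cong₂ _+_ (absorption n k) (absorption n (suc k))) ⟩
  suc n C suc k + (suc n * (n C k) + suc n * (n C suc k))
    ≡⟨ cong (suc n C suc k +_) (sym (*-distribˡ-+ (suc n) (n C k) _)) ⟩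
  suc n C suc k + suc n * (n C k + n C suc k)
    ≡⟨ cong (λ m → suc n C suc k + suc n * m) (pascal n k) ⟩
  suc (suc n) * (suc n C suc k) ∎
  where open ≡-Reasoning

meets : {n : ℕ} → Subset n → Subset n → Bool
meets [] [] = false
meets (b ∷ s) (c ∷ t) = (b ∧ c) ∨ meets s t

meets-false⇒disjoint : {n : ℕ} (s t : Subset n) → meets s t ≡ false → Disjoint s t
meets-false⇒disjoint [] [] _ (_ , ())
meets-false⇒disjoint (true ∷ s) (true ∷ t) ()
meets-false⇒disjoint (true ∷ s) (false ∷ t) _ (zero , ())
meets-false⇒disjoint (false ∷ s) (c ∷ t) _ (zero , ())
meets-false⇒disjoint (true ∷ s) (false ∷ t) e (suc x , there x∈) = meets-false⇒disjoint s t e (x , x∈)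
meets-false⇒disjoint (false ∷ s) (c ∷ t) e (suc x , there x∈) = meets-false⇒disjoint s t e (x , x∈)

empty-meets-nothing : {n : ℕ} (s t : Subset n) → ∣ s ∣ ≡ 0 → meets s t ≡ false
empty-meets-nothing [] [] _ = refl
empty-meets-nothing (true ∷ s) (_ ∷ t) ()
empty-meets-nothing (false ∷ s) (_ ∷ t) e = empty-meets-nothing s t e

subsets-of-size : ∀ m a (L : List (Subset m)) → Unique L → All (λ s → ∣ s ∣ ≡ a) L → length L ≤ m C a
subsets-of-size zero zero L U _ = unique-nil-vectors L U
subsets-of-size zero (suc a) [] _ _ = z≤n
subsets-of-size zero (suc a) ([] ∷ _) _ (() ∷ _)
subsets-of-size (suc m) zero L U A =
  count-by-Bool-head _ 0 (m C 0) no-elements (subsets-of-size m zero) L U A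
  where
  no-elements : ∀ G → Unique G → All (λ t → ∣ true ∷ t ∣ ≡ 0) G → length G ≤ 0
  no-elements [] _ _ = z≤n
  no-elements (_ ∷ _) _ (() ∷ _)
subsets-of-size (suc m) (suc a) L U A =
  subst (length L ≤_) (pascal m a)
    (count-by-Bool-head _ (m C a) (m C suc a)
      (λ G GU GA → subsets-of-size m a G GU (All.map suc-injective GA))
      (subsets-of-size m (suc a)) L U A)

-- Pascal's rule makes C(m,i) non-decreasing in m.
C-grows : ∀ m i → m C i ≤ suc m C i
C-grows m zero = ≤-refl
C-grows m (suc i) = ≤-trans (m≤n+m (m C suc i) (m C i)) (≤-reflexive (pascal m i))

MeetsOfSize : {n : ℕ} → ℕ → Subset n → Subset n → Set
MeetsOfSize j S T = ∣ T ∣ ≡ j × meets T S ≡ true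

-- Each element of S lies in C(m,i) of the (i+1)-subsets of an (m+1)-set, so at most
-- |S|·C(m,i) of them meet S.  The weaker companion bound over an m-set (with C(m,i) in
-- place of C(m-1,i)) covers the tail of a set whose first element lies in S.
meeting-subsets : ∀ m i (S : Subset (suc m)) (L : List (Subset (suc m))) → Unique L →
  All (MeetsOfSize (suc i) S) L → length L ≤ ∣ S ∣ * (m C i)
meeting-subsets-weak : ∀ m i (S : Subset m) (L : List (Subset m)) → Unique L →
  All (MeetsOfSize (suc i) S) L → length L ≤ ∣ S ∣ * (m C i)

meeting-subsets m i (true ∷ S) L U A =
  count-by-Bool-head _ (m C i) (∣ S ∣ * (m C i))
    (λ G GU GA → subsets-of-size m i G GU (All.map (λ (size , _) → suc-injective size) GA))
    (meeting-subsets-weak m i S) L U A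
meeting-subsets zero i (false ∷ []) [] _ _ = z≤n
meeting-subsets zero i (false ∷ []) ((true ∷ []) ∷ _) _ ((_ , ()) ∷ _)
meeting-subsets zero i (false ∷ []) ((false ∷ []) ∷ _) _ ((_ , ()) ∷ _)
meeting-subsets (suc m) zero (false ∷ S) L U A =
  count-by-Bool-head _ 0 (∣ S ∣ * (m C 0)) none (meeting-subsets m zero S) L U A
  where
  none : ∀ G → Unique G → All (λ t → MeetsOfSize 1 (false ∷ S) (true ∷ t)) G → length G ≤ 0
  none [] _ _ = z≤n
  none (T ∷ _) _ ((size , meet) ∷ _) with () ← trans (sym meet) (empty-meets-nothing T S (suc-injective size))
meeting-subsets (suc m) (suc i) (false ∷ S) L U A =
  subst (length L ≤_) (trans (sym (*-distribˡ-+ ∣ S ∣ (m C i) _)) (cong (∣ S ∣ *_) (pascal m i)))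
    (count-by-Bool-head _ (∣ S ∣ * (m C i)) (∣ S ∣ * (m C suc i))
      (λ G GU GA → meeting-subsets m i S G GU (All.map (λ (size , meet) → suc-injective size , meet) GA))
      (meeting-subsets m (suc i) S) L U A)

meeting-subsets-weak zero i [] [] _ _ = z≤n
meeting-subsets-weak zero i [] ([] ∷ _) _ ((() , _) ∷ _)
meeting-subsets-weak (suc m) i S L U A =
  ≤-trans (meeting-subsets m i S L U A) (*-monoʳ-≤ ∣ S ∣ (C-grows m i))

avoids : {n : ℕ} → Subset n → List (Subset n) → Bool
avoids x [] = true
avoids x (q ∷ Q) = not (meets x q) ∧ avoids x Q

avoids-sound : {n : ℕ} (x : Subset n) (Q : List (Subset n)) → avoids x Q ≡ true → All (Disjoint x) Q
avoids-sound x [] _ = []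
avoids-sound x (q ∷ Q) e with meets x q in m
... | false = meets-false⇒disjoint x q m ∷ avoids-sound x Q e

-- The number of fresh entries of v, i.e. those disjoint from all earlier entries and
-- from every member of Q (the entries preceding v).
freshCount : {n k : ℕ} → List (Subset n) → Vec (Subset n) k → ℕ
freshCount Q [] = 0
freshCount Q (x ∷ xs) = (if avoids x Q then 1 else 0) + freshCount (x ∷ Q) xs

staleCount : {n k : ℕ} → List (Subset n) → Vec (Subset n) k → ℕ
staleCount Q [] = 0
staleCount Q (x ∷ xs) = (if avoids x Q then 0 else 1) + staleCount (x ∷ Q) xs

fresh+stale : {n k : ℕ} (Q : List (Subset n)) (v : Vec (Subset n) k) → freshCount Q v + staleCount Q v ≡ k
fresh+stale Q [] = refl
fresh+stale Q (x ∷ xs) with avoids x Q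
... | true = cong suc (fresh+stale (x ∷ Q) xs)
... | false = trans (+-suc _ _) (cong suc (fresh+stale (x ∷ Q) xs))

stale-after-fresh : {n k : ℕ} (h : Subset n) (Q : List (Subset n)) (t : Vec (Subset n) k) →
  avoids h Q ≡ true → staleCount Q (h ∷ t) ≡ staleCount (h ∷ Q) t
stale-after-fresh h Q t fresh rewrite fresh = refl

stale-after-stale : {n k : ℕ} (h : Subset n) (Q : List (Subset n)) (t : Vec (Subset n) k) →
  avoids h Q ≡ false → staleCount Q (h ∷ t) ≡ suc (staleCount (h ∷ Q) t)
stale-after-stale h Q t stale rewrite stale = refl

disjoint-sym : {n : ℕ} {s t : Subset n} → Disjoint s t → Disjoint t s
disjoint-sym {s = s} {t} = subst Empty (∩-comm s t)

record DisjointPicks {n k : ℕ} (Q : List (Subset n)) (v : Vec (Subset n) k) (r : ℕ) : Set where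
  field
    pos : Fin r → Fin k
    increasing : ∀ j l → j F.< l → pos j F.< pos l
    pairwise : ∀ j l → j ≢ l → Disjoint (lookup v (pos j)) (lookup v (pos l))
    avoiding : ∀ j → All (Disjoint (lookup v (pos j))) Q

module _ {n k : ℕ} where
  open DisjointPicks

  no-picks : {Q : List (Subset n)} {v : Vec (Subset n) k} → DisjointPicks Q v 0
  no-picks = record { pos = λ () ; increasing = λ () ; pairwise = λ () ; avoiding = λ () }

  skip-head : {Q : List (Subset n)} {x : Subset n} {xs : Vec (Subset n) k} {r : ℕ} →
    DisjointPicks (x ∷ Q) xs r → DisjointPicks Q (x ∷ xs) r
  skip-head p = record
    { pos = λ j → suc (pos p j)
    ; increasing = λ j l j<l → s≤s (increasing p j l j<l)
    ; pairwise = pairwise p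
    ; avoiding = λ j → All.tail (avoiding p j) }

  take-head : {Q : List (Subset n)} {x : Subset n} {xs : Vec (Subset n) k} {r : ℕ} →
    All (Disjoint x) Q → DisjointPicks (x ∷ Q) xs r → DisjointPicks Q (x ∷ xs) (suc r)
  take-head {Q} {x} {xs} {r} x-avoids p = record
    { pos = pos′ ; increasing = increasing′ ; pairwise = pairwise′ ; avoiding = avoiding′ }
    where
    pos′ : Fin (suc r) → Fin (suc k)
    pos′ zero = zero
    pos′ (suc j) = suc (pos p j)
    increasing′ : ∀ j l → j F.< l → pos′ j F.< pos′ l
    increasing′ zero (suc l) _ = s≤s z≤n
    increasing′ (suc j) (suc l) (s≤s j<l) = s≤s (increasing p j l j<l)
    pairwise′ : ∀ j l → j ≢ l → Disjoint (lookup (x ∷ xs) (pos′ j)) (lookup (x ∷ xs) (pos′ l))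
    pairwise′ zero zero j≢l = ⊥-elim (j≢l refl)
    pairwise′ zero (suc l) _ = disjoint-sym (All.head (avoiding p l))
    pairwise′ (suc j) zero _ = All.head (avoiding p j)
    pairwise′ (suc j) (suc l) j≢l = pairwise p j l (λ eq → j≢l (cong suc eq))
    avoiding′ : ∀ j → All (Disjoint (lookup (x ∷ xs) (pos′ j))) Q
    avoiding′ zero = x-avoids
    avoiding′ (suc j) = All.tail (avoiding p j)

-- The fresh entries are pairwise disjoint, so they furnish disjoint picks.
fresh-picks : {n k : ℕ} (Q : List (Subset n)) (v : Vec (Subset n) k) (r : ℕ) →
  r ≤ freshCount Q v → DisjointPicks Q v r
fresh-picks Q v zero _ = no-picks
fresh-picks Q (x ∷ xs) (suc r) r<fresh with avoids x Q in fresh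
... | true = take-head (avoids-sound x Q fresh) (fresh-picks (x ∷ Q) xs r (≤-pred r<fresh))
... | false = skip-head (fresh-picks (x ∷ Q) xs (suc r) r<fresh)

bad⇒few-fresh : {n d : ℕ} (r : ℕ) (S : Tuple n d) → Bad r S → freshCount [] S < r
bad⇒few-fresh r S bad with r ≤? freshCount [] S
... | yes r≤fresh = ⊥-elim (bad (pos p , increasing p , pairwise p))
  where
  p : DisjointPicks [] S r
  p = fresh-picks [] S r r≤fresh
  open DisjointPicks
... | no r≰fresh = ≰⇒> r≰fresh

bad⇒many-stale : {n d : ℕ} (r : ℕ) (S : Tuple n d) → Bad r S → d + 1 ∸ r ≤ staleCount [] S
bad⇒many-stale {d = d} r S bad = begin
  d + 1 ∸ r ≤⟨ ∸-monoʳ-≤ (d + 1) (bad⇒few-fresh r S bad) ⟩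
  d + 1 ∸ suc fresh ≡⟨ cong (_∸ suc fresh) (+-comm d 1) ⟩
  d ∸ fresh ≡⟨ cong (_∸ fresh) (fresh+stale [] S) ⟨
  fresh + staleCount [] S ∸ fresh ≡⟨ m+n∸m≡n fresh _ ⟩
  staleCount [] S ∎
  where
  open ≤-Reasoning
  fresh : ℕ
  fresh = freshCount [] S

module Counting (n′ a′ : ℕ) where
  n a : ℕ
  n = suc n′
  a = suc a′

  Sized : Subset n → Set
  Sized s = ∣ s ∣ ≡ a

  _≟ₛ_ : DecidableEquality (Subset n)
  _≟ₛ_ = ≡-dec Bool._≟_

  -- A stale a-subset meets one of the |Q| members of Q, and each of them is met by
  -- at most a·C(n-1,a-1) a-subsets.
  stale-subsets : (Q : List (Subset n)) → All Sized Q → (L : List (Subset n)) → Unique L →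
    All (λ h → Sized h × avoids h Q ≡ false) L → length L ≤ length Q * (a * (n′ C a′))
  stale-subsets [] _ [] _ _ = z≤n
  stale-subsets [] _ (_ ∷ _) _ ((_ , ()) ∷ _)
  stale-subsets (q ∷ Q) (q-sized ∷ Q-sized) L U A = begin
    length L
      ≡⟨ length-filter-split meets-q? L ⟨
    length (filter meets-q? L) + length (filter (∁? meets-q?) L)
      ≤⟨ +-mono-≤ meeting-q rest ⟩
    a * (n′ C a′) + length Q * (a * (n′ C a′)) ∎
    where
    open ≤-Reasoning
    meets-q? : Decidable (λ h → meets h q ≡ true)
    meets-q? h = meets h q Bool.≟ true
    meeting-q : length (filter meets-q? L) ≤ a * (n′ C a′)
    meeting-q = subst (λ s → length (filter meets-q? L) ≤ s * (n′ C a′)) q-sized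
      (meeting-subsets n′ a′ q _ (Unique.filter⁺ meets-q? U)
        (All.zipWith (λ ((sized , _) , meet) → sized , meet) (All.filter⁺ meets-q? A , All.all-filter meets-q? L)))
    still-stale : ∀ h → avoids h (q ∷ Q) ≡ false → meets h q ≢ true → avoids h Q ≡ false
    still-stale h stale misses with meets h q
    ... | true = ⊥-elim (misses refl)
    ... | false = stale
    rest : length (filter (∁? meets-q?) L) ≤ length Q * (a * (n′ C a′))
    rest = stale-subsets Q Q-sized _ (Unique.filter⁺ (∁? meets-q?) U)
      (All.zipWith (λ {h} ((sized , stale) , misses) → sized , still-stale h stale misses)
        (All.filter⁺ (∁? meets-q?) A , All.all-filter (∁? meets-q?) L))

  Cn : ℕ
  Cn = n C a

  SizedTuple : {k : ℕ} → Vec (Subset n) k → Set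
  SizedTuple = VecAll Sized

  sized-tuples : ∀ k (L : List (Vec (Subset n) k)) → Unique L → All SizedTuple L → length L ≤ Cn ^ k
  sized-tuples zero L U _ = unique-nil-vectors L U
  sized-tuples (suc k) L U A =
    let (hs , hs-unique , hs-heads , count) = count-by-distinct-heads _≟ₛ_ SizedTuple 1 (Cn ^ k) tails L U A
    in begin
      length L ≡⟨ *-identityʳ _ ⟨
      length L * 1 ≤⟨ count ⟩
      length hs * Cn ^ k ≤⟨ *-monoˡ-≤ (Cn ^ k) (subsets-of-size n a hs hs-unique (All.map head-sized hs-heads)) ⟩
      Cn * Cn ^ k ∎
    where
    open ≤-Reasoning
    tails : ∀ h G → Unique G → All (λ t → SizedTuple (h ∷ t)) G → length G * 1 ≤ Cn ^ k
    tails h G GU GA = ≤-trans (≤-reflexive (*-identityʳ _)) (sized-tuples k G GU (All.map VecAll.tail GA))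
    head-sized : ∀ {h} → ∃ (λ t → SizedTuple (h ∷ t)) → Sized h
    head-sized (_ , sized ∷ _) = sized

  ManyStale : {k : ℕ} → List (Subset n) → ℕ → Vec (Subset n) k → Set
  ManyStale Q m v = SizedTuple v × m ≤ staleCount Q v

  Estimate : ℕ → ℕ → Set
  Estimate d k = (Q : List (Subset n)) → All Sized Q → length Q + k ≤ d → (m : ℕ)
    (L : List (Vec (Subset n) k)) → Unique L → All (ManyStale Q m) L →
    length L * n ^ m ≤ suc d ^ k * ((a * a) ^ m * Cn ^ k)

  estimate-no-stale : ∀ d k (Q : List (Subset n)) (L : List (Vec (Subset n) k)) → Unique L → All (ManyStale Q 0) L →
    length L * n ^ 0 ≤ suc d ^ k * ((a * a) ^ 0 * Cn ^ k)
  estimate-no-stale d k Q L U A = begin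
    length L * 1 ≡⟨ *-identityʳ _ ⟩
    length L ≤⟨ sized-tuples k L U (All.map proj₁ A) ⟩
    Cn ^ k ≡⟨ *-identityˡ _ ⟨
    1 * Cn ^ k ≡⟨ *-identityˡ _ ⟨
    1 * (1 * Cn ^ k) ≤⟨ *-monoˡ-≤ (1 * Cn ^ k) (m^n>0 (suc d) k) ⟩
    suc d ^ k * (1 * Cn ^ k) ∎
    where open ≤-Reasoning

  extend-prefix : ∀ {d k} (h : Subset n) (Q : List (Subset n)) → length Q + suc k ≤ d → length (h ∷ Q) + k ≤ d
  extend-prefix {k = k} h Q room = ≤-trans (≤-reflexive (sym (+-suc (length Q) k))) room

  -- Tuples with a fresh head: at most C(n,a) heads, each followed by tails that have
  -- all m stale entries after the extended prefix.
  fresh-headed : ∀ {d k} → Estimate d k → (Q : List (Subset n)) → All Sized Q → length Q + suc k ≤ d → (m : ℕ)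
    (L : List (Vec (Subset n) (suc k))) → Unique L →
    All (λ v → ManyStale Q m v × avoids (head v) Q ≡ true) L →
    length L * n ^ m ≤ Cn * (suc d ^ k * ((a * a) ^ m * Cn ^ k))
  fresh-headed {d} {k} estimate Q Q-sized room m L U A =
    let (hs , hs-unique , hs-heads , count) = count-by-distinct-heads _≟ₛ_ _ (n ^ m) _ tails L U A
    in ≤-trans count (*-monoˡ-≤ _ (subsets-of-size n a hs hs-unique (All.map head-sized hs-heads)))
    where
    tail-stale : ∀ {h t} → ManyStale Q m (h ∷ t) × avoids h Q ≡ true → ManyStale (h ∷ Q) m t
    tail-stale {h} {t} ((_ ∷ t-sized , stale) , fresh) = t-sized , subst (m ≤_) (stale-after-fresh h Q t fresh) stale
    tails : ∀ h G → Unique G → All (λ t → ManyStale Q m (h ∷ t) × avoids h Q ≡ true) G →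
      length G * n ^ m ≤ suc d ^ k * ((a * a) ^ m * Cn ^ k)
    tails h [] _ _ = z≤n
    tails h G@(_ ∷ _) GU GA@(((h-sized ∷ _ , _) , _) ∷ _) =
      estimate (h ∷ Q) (h-sized ∷ Q-sized) (extend-prefix h Q room) m G GU (All.map tail-stale GA)
    head-sized : ∀ {h} → ∃ (λ t → ManyStale Q m (h ∷ t) × avoids h Q ≡ true) → Sized h
    head-sized (_ , ((sized ∷ _ , _) , _)) = sized

  -- Tuples with a stale head: at most |Q|·a·C(n-1,a-1) heads, each followed by tails with
  -- one stale entry fewer, which costs a factor n.
  stale-headed : ∀ {d k} → Estimate d k → (Q : List (Subset n)) → All Sized Q → length Q + suc k ≤ d → (m : ℕ)
    (L : List (Vec (Subset n) (suc k))) → Unique L →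
    All (λ v → ManyStale Q (suc m) v × avoids (head v) Q ≡ false) L →
    length L * n ^ suc m ≤ length Q * (a * (n′ C a′)) * (n * (suc d ^ k * ((a * a) ^ m * Cn ^ k)))
  stale-headed {d} {k} estimate Q Q-sized room m L U A =
    let (hs , hs-unique , hs-heads , count) = count-by-distinct-heads _≟ₛ_ _ (n ^ suc m) _ tails L U A
    in ≤-trans count (*-monoˡ-≤ _ (stale-subsets Q Q-sized hs hs-unique (All.map stale-head hs-heads)))
    where
    tail-stale : ∀ {h t} → ManyStale Q (suc m) (h ∷ t) × avoids h Q ≡ false → ManyStale (h ∷ Q) m t
    tail-stale {h} {t} ((_ ∷ t-sized , stale) , not-fresh) =
      t-sized , ≤-pred (subst (suc m ≤_) (stale-after-stale h Q t not-fresh) stale)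
    tails : ∀ h G → Unique G → All (λ t → ManyStale Q (suc m) (h ∷ t) × avoids h Q ≡ false) G →
      length G * n ^ suc m ≤ n * (suc d ^ k * ((a * a) ^ m * Cn ^ k))
    tails h [] _ _ = z≤n
    tails h G@(_ ∷ _) GU GA@(((h-sized ∷ _ , _) , _) ∷ _) = begin
      length G * (n * n ^ m) ≡⟨ x∙yz≈y∙xz (length G) n (n ^ m) ⟩
      n * (length G * n ^ m) ≤⟨ *-monoʳ-≤ n (estimate (h ∷ Q) (h-sized ∷ Q-sized) (extend-prefix h Q room) m G GU
                                              (All.map tail-stale GA)) ⟩
      n * (suc d ^ k * ((a * a) ^ m * Cn ^ k)) ∎
      where open ≤-Reasoning
    stale-head : ∀ {h} → ∃ (λ t → ManyStale Q (suc m) (h ∷ t) × avoids h Q ≡ false) → Sized h × avoids h Q ≡ false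
    stale-head (_ , ((sized ∷ _ , _) , not-fresh)) = sized , not-fresh

  -- Both parts of the estimate for length k+1 are multiples of the same quantity; the
  -- stale part needs the absorption identity a·C(n,a) = n·C(n-1,a-1).
  combine-parts : ∀ q D P K →
    Cn * (D * ((a * a) * P * K)) + q * (a * (n′ C a′)) * (n * (D * (P * K))) ≡ suc q * (D * ((a * a) * P * (Cn * K)))
  combine-parts q D P K = begin
    Cn * (D * ((a * a) * P * K)) + q * (a * (n′ C a′)) * (n * (D * (P * K)))
      ≡⟨ cong₂ _+_ (fresh-share Cn D (a * a) P K) (stale-share q a (n′ C a′) n D P K) ⟩
    T + q * (n * (n′ C a′)) * (a * D * P * K)
      ≡⟨ cong (λ x → T + q * x * (a * D * P * K)) (absorption n′ a′) ⟨
    T + q * (a * Cn) * (a * D * P * K)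
      ≡⟨ cong (T +_) (regroup q a Cn D P K) ⟩
    T + q * T ∎
    where
    open ≡-Reasoning
    T : ℕ
    T = D * ((a * a) * P * (Cn * K))
    fresh-share : ∀ c D s P K → c * (D * (s * P * K)) ≡ D * (s * P * (c * K))
    fresh-share = solve-∀
    stale-share : ∀ q a c n D P K → q * (a * c) * (n * (D * (P * K))) ≡ q * (n * c) * (a * D * P * K)
    stale-share = solve-∀
    regroup : ∀ q a c D P K → q * (a * c) * (a * D * P * K) ≡ q * (D * ((a * a) * P * (c * K)))
    regroup = solve-∀

  estimate-step : ∀ {d k} → Estimate d k → Estimate d (suc k)
  estimate-step {d} {k} _ Q _ _ zero L U A = estimate-no-stale d (suc k) Q L U A
  estimate-step {d} {k} estimate Q Q-sized room (suc m) L U A = begin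
    length L * n ^ suc m
      ≡⟨ cong (_* n ^ suc m) (length-filter-split fresh? L) ⟨
    (length (filter fresh? L) + length (filter (∁? fresh?) L)) * n ^ suc m
      ≡⟨ *-distribʳ-+ (n ^ suc m) (length (filter fresh? L)) _ ⟩
    length (filter fresh? L) * n ^ suc m + length (filter (∁? fresh?) L) * n ^ suc m
      ≤⟨ +-mono-≤ (fresh-headed estimate Q Q-sized room (suc m) _ (Unique.filter⁺ fresh? U)
                    (All.zip (All.filter⁺ fresh? A , All.all-filter fresh? L)))
                  (stale-headed estimate Q Q-sized room m _ (Unique.filter⁺ (∁? fresh?) U)
                    (All.zipWith (λ (many , not-fresh) → many , ¬-not not-fresh)
                      (All.filter⁺ (∁? fresh?) A , All.all-filter (∁? fresh?) L))) ⟩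
    Cn * (D * ((a * a) ^ suc m * K)) + length Q * (a * (n′ C a′)) * (n * (D * ((a * a) ^ m * K)))
      ≡⟨ combine-parts (length Q) D ((a * a) ^ m) K ⟩
    suc (length Q) * T
      ≤⟨ *-monoˡ-≤ T (s≤s prefix-bound) ⟩
    suc d * (D * T′)
      ≡⟨ *-assoc (suc d) D T′ ⟨
    suc d ^ suc k * ((a * a) ^ suc m * Cn ^ suc k) ∎
    where
    open ≤-Reasoning
    D K T′ T : ℕ
    D = suc d ^ k
    K = Cn ^ k
    T′ = (a * a) * (a * a) ^ m * (Cn * K)
    T = D * T′
    fresh? : Decidable (λ (v : Vec (Subset n) (suc k)) → avoids (head v) Q ≡ true)
    fresh? v = avoids (head v) Q Bool.≟ true
    prefix-bound : length Q ≤ d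
    prefix-bound = ≤-trans (m≤m+n (length Q) (suc k)) room

  -- For length 0 only m = 0 is possible, as such a tuple has no stale entry.
  estimate : ∀ d k → Estimate d k
  estimate d zero Q _ _ zero L U A = estimate-no-stale d zero Q L U A
  estimate d zero Q _ _ (suc m) [] _ _ = z≤n
  estimate d zero Q _ _ (suc m) ([] ∷ _) _ ((_ , ()) ∷ _)
  estimate d (suc k) = estimate-step (estimate d k)

lemma11 : (d : ℕ) → 1 ≤ d →
    Σ ℕ λ K →
      (n a r : ℕ) → 1 ≤ a → a ≤ n → 1 ≤ r → r ≤ d + 1 →
      (L : List (Tuple n d)) → Unique L →
      All (λ S → AllOfSize a S × Bad r S) L →
      length L * n ^ (d + 1 ∸ r) ≤ K * (a ^ (2 * (d + 1 ∸ r)) * (n C a) ^ d)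
lemma11 d _ = suc d ^ d , bound
  where
  bound : (n a r : ℕ) → 1 ≤ a → a ≤ n → 1 ≤ r → r ≤ d + 1 →
    (L : List (Tuple n d)) → Unique L → All (λ S → AllOfSize a S × Bad r S) L →
    length L * n ^ (d + 1 ∸ r) ≤ suc d ^ d * (a ^ (2 * (d + 1 ∸ r)) * (n C a) ^ d)
  bound (suc n′) (suc a′) r (s≤s z≤n) (s≤s _) _ _ L U A =
    subst (λ x → length L * n ^ e ≤ suc d ^ d * (x * Cn ^ d)) squares
      (estimate d d [] [] ≤-refl e L U (All.map many-stale A))
    where
    open Counting n′ a′
    e : ℕ
    e = d + 1 ∸ r
    many-stale : {S : Tuple n d} → AllOfSize a S × Bad r S → ManyStale [] e S
    many-stale {S} (sized , bad) = VecAll.lookup⁻ sized , bad⇒many-stale r S bad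
    squares : (a * a) ^ e ≡ a ^ (2 * e)
    squares = trans (cong (λ x → (a * x) ^ e) (sym (*-identityʳ a))) (^-*-assoc a 2 e)
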